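{- Let $p$ be a prime, and let $\mathbb{F}_p$ denote the field with $p$ elements. Then every subset $A \subseteq \mathbb{F}_p \setminus \{0\}$ of size $|A| \leq \frac{\log p}{\log\log p}$ has a valid ordering, i.e., there is an ordering $a_1, \ldots, a_{|A|}$ of the elements of $A$ such that the partial sums $a_1,\ a_1+a_2,\ \ldots,\ a_1+a_2+\cdots+a_{|A|}$ are pairwise distinct.
   Context: Here $\log$ denotes the natural logarithm. -}

module Defs where

open import Data.Nat as ℕ using (ℕ; zero; suc; _+_; _≤_; _<_; NonZero)
open import Data.Nat.DivMod using (_%_)
open import Data.Integer using (+_)
open import Data.Rational as ℚ using (ℚ; 0ℚ; 1ℚ)
open import Data.Product using (_×_; ∃-syntax)
open import Data.List using (List; []; _∷_; map)

qpow : ℚ → ℕ → ℚ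
qpow r zero    = 1ℚ
qpow r (suc k) = r ℚ.* qpow r k

expTerm : ℚ → ℕ → ℚ
expTerm r zero    = 1ℚ
expTerm r (suc n) = (expTerm r n ℚ.* r) ℚ.* (+ 1 ℚ./ suc n)

expPartial : ℚ → ℕ → ℚ
expPartial r zero    = 0ℚ
expPartial r (suc N) = expPartial r N ℚ.+ expTerm r N

toℚ : ℕ → ℚ
toℚ n = + n ℚ./ 1

-- LogBound p k  encodes the real inequality  k ≤ log p / log log p.
-- For p ≥ 3 we have log log p > 0 and the inequality is equivalent to
-- (log p)^k ≤ p, i.e. p ≤ exp (p^(1/k)); equality is impossible
-- (Lindemann–Weierstrass), so this is p < exp (p^(1/k)), which holds iff
-- some rational r ≥ 0 with r^k ≤ p has some partial sum of exp r exceeding p.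
-- For p = 2 we have log log 2 < 0, so no k ∈ ℕ satisfies the inequality.
LogBound : ℕ → ℕ → Set
LogBound p k =
  3 ≤ p ×
  ∃[ r ] (0ℚ ℚ.≤ r × qpow r k ℚ.≤ toℚ p × ∃[ N ] toℚ p ℚ.< expPartial r N)

partialSums : List ℕ → List ℕ
partialSums = go 0
  where
  go : ℕ → List ℕ → List ℕ
  go s []       = []
  go s (x ∷ xs) = (s + x) ∷ go (s + x) xs

-- Elements of 𝔽_p are represented by 0, …, p-1 with addition mod p;
-- partial sums in 𝔽_p are the natural-number partial sums reduced mod p.
partialSumsMod : (p : ℕ) .{{_ : NonZero p}} → List ℕ → List ℕ
partialSumsMod p xs = map (_% p) (partialSums xs)

-- Write k = |A| and r = p^(1/k). The hypothesis k ≤ log p / log log p says p < e^r, and for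
-- j ≤ r ≤ j + 1 with j ≥ 3 the exponential series is dominated by r^(j+1); together with a
-- numerical bootstrap for r < 3 (which needs p ≥ 5, automatic once k ≥ 4) this forces r ≥ k,
-- i.e. k^k ≤ p, and equality is excluded as p is prime. By pigeonhole on the k^k possible vectors
-- (⌊k·(l a mod p)/p⌋)_{a ∈ A}, 0 ≤ l < p, two dilations l₁ < l₂ agree, so D = l₂ - l₁ ≢ 0 has,
-- for every a ∈ A, an integer representative w a ≡ D a (mod p) with |w a| < p/k; hence
-- Σ |w a| < p. The integers w a are distinct and nonzero, and every such list of integers has an
-- ordering with distinct partial sums. Since any two partial sums of w differ by at most
-- Σ |w a| < p, they stay distinct mod p, and dividing by D gives a valid ordering of A.
-- Sets with at most three elements are ordered by hand.
module Submission where

open import Defs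

module Lists where

  open import Data.Nat as ℕ using (ℕ; zero; suc; NonZero; z≤n; s≤s)
  import Data.Nat.Properties as ℕ
  open import Data.Nat.ListAction using (sum)
  open import Data.List using (List; []; _∷_; map; length)
  open import Data.List.Relation.Unary.All as All using (All; []; _∷_)
  import Data.List.Relation.Unary.All.Properties as All
  open import Data.List.Relation.Unary.Any using (Any; any?)
  open import Data.List.Relation.Unary.AllPairs using (AllPairs; []; _∷_)
  open import Data.List.Relation.Unary.Unique.Propositional using (Unique)
  open import Data.List.Relation.Binary.Pointwise using (Pointwise; []; _∷_)
  open import Data.List.Membership.Propositional using (find)
  open import Data.List.Membership.Propositional.Properties using (∈-∃++)
  open import Data.List.Relation.Binary.Permutation.Propositional using (_↭_; ↭⇒↭ₛ)
  open import Data.List.Relation.Binary.Permutation.Propositional.Properties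
    using (All-resp-↭; ↭-length; shift)
  import Data.List.Relation.Binary.Permutation.Setoid.Properties as Permutationₛ
  open import Data.Product using (_×_; _,_; ∃₂)
  open import Relation.Nullary using (yes; no)
  open import Relation.Binary.PropositionalEquality
    using (_≡_; refl; sym; subst; setoid; ≢-sym)

  Unique-resp-↭ : ∀ {A : Set} {xs ys : List A} → xs ↭ ys → Unique xs → Unique ys
  Unique-resp-↭ {A} xs↭ys = Permutationₛ.Unique-resp-↭ (setoid A) (↭⇒↭ₛ xs↭ys)

  ↭-pick : ∀ {A : Set} {P : A → Set} {xs : List A} → Any P xs → ∃₂ λ x rest → P x × xs ↭ x ∷ rest
  ↭-pick any with x , x∈xs , px ← find any with ys , zs , refl ← ∈-∃++ x∈xs =
    x , _ , px , shift x ys zs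

  Unique-map-on : ∀ {A B : Set} {P : A → Set} {f : A → B} {xs} →
                  (∀ {x y} → P x → P y → f x ≡ f y → x ≡ y) → All P xs → Unique xs → Unique (map f xs)
  Unique-map-on injective []         []        = []
  Unique-map-on injective (px ∷ pxs) (x∉ ∷ xs) =
    All.map⁺ (All.zipWith (λ (x≢y , py) fx≡fy → x≢y (injective px py fx≡fy)) (x∉ , pxs))
    ∷ Unique-map-on injective pxs xs

  Unique⇒length≤ : ∀ n {xs} → Unique xs → All (ℕ._< n) xs → length xs ℕ.≤ n
  Unique⇒length≤ zero    {[]}    _      _        = z≤n
  Unique⇒length≤ zero    {_ ∷ _} _      (() ∷ _)
  Unique⇒length≤ (suc n) {xs}    unique bound with any? (ℕ._≟ n) xs
  ... | no n∉xs = ℕ.m≤n⇒m≤1+n (Unique⇒length≤ n unique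
    (All.zipWith (λ (x<1+n , x≢n) → ℕ.≤∧≢⇒< (ℕ.≤-pred x<1+n) x≢n)
                 (bound , All.¬Any⇒All¬ xs n∉xs)))
  ... | yes n∈xs
    with _ , rest , refl , xs↭ ← ↭-pick n∈xs
    with n∉rest ∷ unique′ ← Unique-resp-↭ xs↭ unique
    with _ ∷ bound′ ← All-resp-↭ xs↭ bound
    = subst (ℕ._≤ suc n) (sym (↭-length xs↭)) (s≤s (Unique⇒length≤ n unique′
        (All.zipWith (λ (x<1+n , n≢x) → ℕ.≤∧≢⇒< (ℕ.≤-pred x<1+n) (≢-sym n≢x)) (bound′ , n∉rest))))

  *n<p⇒sum<p : ∀ {n p} .{{_ : NonZero n}} .{{_ : NonZero p}} xs →
              length xs ℕ.≤ n → All (λ x → x ℕ.* n ℕ.< p) xs → sum xs ℕ.< p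
  *n<p⇒sum<p {n} {p} xs len≤n bounds =
    ℕ.m≤pred[n]⇒suc[m]≤n (ℕ.*-cancelʳ-≤ (sum xs) (ℕ.pred p) n (begin
    sum xs ℕ.* n            ≤⟨ sum*≤ xs bounds ⟩
    length xs ℕ.* ℕ.pred p  ≤⟨ ℕ.*-monoˡ-≤ (ℕ.pred p) len≤n ⟩
    n ℕ.* ℕ.pred p          ≡⟨ ℕ.*-comm n (ℕ.pred p) ⟩
    ℕ.pred p ℕ.* n          ∎))
    where
    open ℕ.≤-Reasoning
    sum*≤ : ∀ xs → All (λ x → x ℕ.* n ℕ.< p) xs → sum xs ℕ.* n ℕ.≤ length xs ℕ.* ℕ.pred p
    sum*≤ []       []       = z≤n
    sum*≤ (x ∷ xs) (b ∷ bs) = subst (ℕ._≤ ℕ.pred p ℕ.+ length xs ℕ.* ℕ.pred p)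
      (sym (ℕ.*-distribʳ-+ n x (sum xs))) (ℕ.+-mono-≤ (ℕ.<⇒≤pred b) (sum*≤ xs bs))

  module _ {A B : Set} {R : A → B → Set} {S : A → A → Set} {T : B → B → Set}
           (transport : ∀ {x x′ y y′} → R x y → R x′ y′ → S x x′ → T y y′) where

    All-transport : ∀ {x y xs ys} → R x y → Pointwise R xs ys → All (S x) xs → All (T y) ys
    All-transport rxy []       []       = []
    All-transport rxy (r ∷ rs) (s ∷ ss) = transport rxy r s ∷ All-transport rxy rs ss

    AllPairs-transport : ∀ {xs ys} → Pointwise R xs ys → AllPairs S xs → AllPairs T ys
    AllPairs-transport []       []       = []
    AllPairs-transport (r ∷ rs) (s ∷ ss) = All-transport r rs s ∷ AllPairs-transport rs ss

module ExponentialSeries where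

  open import Data.Nat as ℕ using (ℕ; zero; suc; z≤n; s≤s; _!; _≤‴_; _≤′_)
  import Data.Nat.Properties as ℕ
  import Data.Nat.Coprimality as Coprime
  open import Data.Integer as ℤ using (+_)
  import Data.Integer.Properties as ℤ
  open import Data.Rational as ℚ using (ℚ; mkℚ; 0ℚ; 1ℚ; _≤_; _<_; _+_; _*_; *≤*)
  import Data.Rational.Properties as ℚ
  open import Data.Rational.Solver using (module +-*-Solver)
  open +-*-Solver using (solve; _:+_; _:*_; _:=_; con)
  open import Data.Product using (_×_; _,_; ∃-syntax)
  open import Data.Empty using (⊥-elim)
  open import Data.Sum using ([_,_]′)
  open import Relation.Nullary using (¬_; yes; no)
  open import Data.Unit using (tt)
  open import Relation.Binary.PropositionalEquality
    using (_≡_; refl; sym; trans; cong; cong₂; subst; subst₂; module ≡-Reasoning)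

  toℚ≡mkℚ : ∀ n → toℚ n ≡ mkℚ (+ n) 0 (Coprime.sym (Coprime.1-coprimeTo n))
  toℚ≡mkℚ n = ℚ.normalize-coprime _

  toℚ-mono-≤ : ∀ {m n} → m ℕ.≤ n → toℚ m ≤ toℚ n
  toℚ-mono-≤ {m} {n} m≤n rewrite toℚ≡mkℚ m | toℚ≡mkℚ n =
    *≤* (subst₂ ℤ._≤_ (sym (ℤ.*-identityʳ (+ m))) (sym (ℤ.*-identityʳ (+ n))) (ℤ.+≤+ m≤n))

  toℚ-cancel-≤ : ∀ {m n} → toℚ m ≤ toℚ n → m ℕ.≤ n
  toℚ-cancel-≤ {m} {n} le rewrite toℚ≡mkℚ m | toℚ≡mkℚ n with le
  ... | *≤* m≤n = ℤ.drop‿+≤+ (subst₂ ℤ._≤_ (ℤ.*-identityʳ (+ m)) (ℤ.*-identityʳ (+ n)) m≤n)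

  toℚ-nonNeg : ∀ n → 0ℚ ≤ toℚ n
  toℚ-nonNeg n = toℚ-mono-≤ {0} {n} z≤n

  toℚ-+ : ∀ m n → toℚ (m ℕ.+ n) ≡ toℚ m + toℚ n
  toℚ-+ m n = trans
    (cong (ℚ._/ 1) (trans (ℤ.pos-+ m n) (sym (cong₂ ℤ._+_ (ℤ.*-identityʳ (+ m)) (ℤ.*-identityʳ (+ n))))))
    (cong₂ _+_ (sym (toℚ≡mkℚ m)) (sym (toℚ≡mkℚ n)))

  toℚ-* : ∀ m n → toℚ (m ℕ.* n) ≡ toℚ m * toℚ n
  toℚ-* m n = trans (cong (ℚ._/ 1) (ℤ.pos-* m n)) (cong₂ _*_ (sym (toℚ≡mkℚ m)) (sym (toℚ≡mkℚ n)))

  1/suc : ℕ → ℚ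
  1/suc n = + 1 ℚ./ suc n

  1/suc-nonNeg : ∀ n → 0ℚ ≤ 1/suc n
  1/suc-nonNeg n = ℚ.nonNegative⁻¹ (1/suc n) {{ℚ.normalize-nonNeg 1 (suc n)}}

  toℚ-suc-*-1/suc : ∀ n → toℚ (suc n) * 1/suc n ≡ 1ℚ
  toℚ-suc-*-1/suc n rewrite toℚ≡mkℚ (suc n) | ℚ.normalize-coprime (Coprime.1-coprimeTo (suc n)) =
    ℚ.*-inverseʳ (mkℚ (+ suc n) 0 (Coprime.sym (Coprime.1-coprimeTo (suc n))))

  *-nonNeg : ∀ {a b} → 0ℚ ≤ a → 0ℚ ≤ b → 0ℚ ≤ a * b
  *-nonNeg {a} {b} 0≤a 0≤b =
    ℚ.nonNegative⁻¹ (a * b) {{ℚ.nonNeg*nonNeg⇒nonNeg a {{ℚ.nonNegative 0≤a}} b {{ℚ.nonNegative 0≤b}}}}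

  *-monoˡ-≤-nonNeg : ∀ {a b} c → 0ℚ ≤ c → a ≤ b → c * a ≤ c * b
  *-monoˡ-≤-nonNeg c 0≤c = ℚ.*-monoˡ-≤-nonNeg c {{ℚ.nonNegative 0≤c}}

  *-monoʳ-≤-nonNeg : ∀ {a b} c → 0ℚ ≤ c → a ≤ b → a * c ≤ b * c
  *-monoʳ-≤-nonNeg c 0≤c = ℚ.*-monoʳ-≤-nonNeg c {{ℚ.nonNegative 0≤c}}

  *-mono-≤-nonNeg : ∀ {a b c d} → 0ℚ ≤ a → 0ℚ ≤ c → a ≤ b → c ≤ d → a * c ≤ b * d
  *-mono-≤-nonNeg {b = b} {c} 0≤a 0≤c a≤b c≤d =
    ℚ.≤-trans (*-monoʳ-≤-nonNeg c 0≤c a≤b) (*-monoˡ-≤-nonNeg b (ℚ.≤-trans 0≤a a≤b) c≤d)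

  ≤-+-nonNeg : ∀ a {b} → 0ℚ ≤ b → a ≤ a + b
  ≤-+-nonNeg a {b} 0≤b = subst (_≤ a + b) (ℚ.+-identityʳ a) (ℚ.+-monoʳ-≤ a 0≤b)

  module _ (a : ℕ → ℚ) where

    ascending⇒≤ : ∀ {m n} → (∀ {i} → i ℕ.< n → a i ≤ a (suc i)) → m ≤‴ n → a m ≤ a n
    ascending⇒≤ step ℕ.≤‴-refl        = ℚ.≤-refl
    ascending⇒≤ step (ℕ.≤‴-step m<n) =
      ℚ.≤-trans (step (ℕ.≤‴⇒≤ m<n)) (ascending⇒≤ step m<n)

    descending⇒≤ : ∀ {m n} → (∀ {i} → m ℕ.≤ i → a (suc i) ≤ a i) → m ≤′ n → a n ≤ a m
    descending⇒≤ step ℕ.≤′-refl        = ℚ.≤-refl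
    descending⇒≤ step (ℕ.≤′-step m≤n) =
      ℚ.≤-trans (step (ℕ.≤′⇒≤ m≤n)) (descending⇒≤ step m≤n)

  qpow-nonNeg : ∀ {r} → 0ℚ ≤ r → ∀ k → 0ℚ ≤ qpow r k
  qpow-nonNeg 0≤r zero    = toℚ-nonNeg 1
  qpow-nonNeg 0≤r (suc k) = *-nonNeg 0≤r (qpow-nonNeg 0≤r k)

  qpow-monoˡ-≤ : ∀ {r s} → 0ℚ ≤ r → r ≤ s → ∀ k → qpow r k ≤ qpow s k
  qpow-monoˡ-≤ 0≤r r≤s zero    = ℚ.≤-refl
  qpow-monoˡ-≤ 0≤r r≤s (suc k) = *-mono-≤-nonNeg 0≤r (qpow-nonNeg 0≤r k) r≤s (qpow-monoˡ-≤ 0≤r r≤s k)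

  qpow-monoʳ-≤ : ∀ {r} → 1ℚ ≤ r → ∀ {m n} → m ℕ.≤ n → qpow r m ≤ qpow r n
  qpow-monoʳ-≤ {r} 1≤r m≤n = ascending⇒≤ (qpow r) step (ℕ.≤⇒≤‴ m≤n)
    where
    step : ∀ {i} → i ℕ.< _ → qpow r i ≤ qpow r (suc i)
    step {i} _ = subst (_≤ r * qpow r i) (ℚ.*-identityˡ (qpow r i))
      (*-monoʳ-≤-nonNeg (qpow r i) (qpow-nonNeg (ℚ.≤-trans (toℚ-nonNeg 1) 1≤r) i) 1≤r)

  qpow-toℚ : ∀ k n → qpow (toℚ k) n ≡ toℚ (k ℕ.^ n)
  qpow-toℚ k zero    = refl
  qpow-toℚ k (suc n) = trans (cong (toℚ k *_) (qpow-toℚ k n)) (sym (toℚ-* k (k ℕ.^ n)))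

  expTerm-suc : ∀ r n → expTerm r (suc n) ≡ expTerm r n * (r * 1/suc n)
  expTerm-suc r n = ℚ.*-assoc (expTerm r n) r (1/suc n)

  expTerm-nonNeg : ∀ {r} → 0ℚ ≤ r → ∀ n → 0ℚ ≤ expTerm r n
  expTerm-nonNeg 0≤r zero    = toℚ-nonNeg 1
  expTerm-nonNeg 0≤r (suc n) = *-nonNeg (*-nonNeg (expTerm-nonNeg 0≤r n) 0≤r) (1/suc-nonNeg n)

  expTerm-monoˡ-≤ : ∀ {r s} → 0ℚ ≤ r → r ≤ s → ∀ n → expTerm r n ≤ expTerm s n
  expTerm-monoˡ-≤ 0≤r r≤s zero    = ℚ.≤-refl
  expTerm-monoˡ-≤ 0≤r r≤s (suc n) = *-monoʳ-≤-nonNeg _ (1/suc-nonNeg n)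
    (*-mono-≤-nonNeg (expTerm-nonNeg 0≤r n) 0≤r (expTerm-monoˡ-≤ 0≤r r≤s n) r≤s)

  expTerm-*-! : ∀ r n → expTerm r n * toℚ (n !) ≡ qpow r n
  expTerm-*-! r zero    = ℚ.*-identityˡ 1ℚ
  expTerm-*-! r (suc n) = begin
    t * r * 1/suc n * toℚ (suc n ℕ.* n !)
      ≡⟨ cong (t * r * 1/suc n *_) (toℚ-* (suc n) (n !)) ⟩
    t * r * 1/suc n * (toℚ (suc n) * f)
      ≡⟨ solve 5 (λ t r i s f → t :* r :* i :* (s :* f) := r :* (t :* f :* (s :* i)))
               refl t r (1/suc n) (toℚ (suc n)) f ⟩
    r * (t * f * (toℚ (suc n) * 1/suc n))
      ≡⟨ cong₂ (λ a b → r * (a * b)) (expTerm-*-! r n) (toℚ-suc-*-1/suc n) ⟩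
    r * (qpow r n * 1ℚ)
      ≡⟨ cong (r *_) (ℚ.*-identityʳ (qpow r n)) ⟩
    r * qpow r n ∎
    where
    open ≡-Reasoning
    t f : ℚ
    t = expTerm r n
    f = toℚ (n !)

  expPartial-monoˡ-≤ : ∀ {r s} → 0ℚ ≤ r → r ≤ s → ∀ N → expPartial r N ≤ expPartial s N
  expPartial-monoˡ-≤ 0≤r r≤s zero    = ℚ.≤-refl
  expPartial-monoˡ-≤ 0≤r r≤s (suc N) =
    ℚ.+-mono-≤ (expPartial-monoˡ-≤ 0≤r r≤s N) (expTerm-monoˡ-≤ 0≤r r≤s N)

  expPartial-monoʳ-≤ : ∀ {r} → 0ℚ ≤ r → ∀ {M N} → M ℕ.≤ N → expPartial r M ≤ expPartial r N
  expPartial-monoʳ-≤ {r} 0≤r M≤N =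
    ascending⇒≤ (expPartial r) (λ {i} _ → ≤-+-nonNeg (expPartial r i) (expTerm-nonNeg 0≤r i))
      (ℕ.≤⇒≤‴ M≤N)

  *-≤-of-≤1 : ∀ {x y} → 0ℚ ≤ x → y ≤ 1ℚ → x * y ≤ x
  *-≤-of-≤1 {x} {y} 0≤x y≤1 = subst (x * y ≤_) (ℚ.*-identityʳ x) (*-monoˡ-≤-nonNeg x 0≤x y≤1)

  ≤-*-of-1≤ : ∀ {x y} → 0ℚ ≤ x → 1ℚ ≤ y → x ≤ x * y
  ≤-*-of-1≤ {x} {y} 0≤x 1≤y = subst (_≤ x * y) (ℚ.*-identityʳ x) (*-monoˡ-≤-nonNeg x 0≤x 1≤y)

  *-1/suc-≤-1 : ∀ {a} n → a ≤ toℚ (suc n) → a * 1/suc n ≤ 1ℚ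
  *-1/suc-≤-1 {a} n a≤n+1 = subst (a * 1/suc n ≤_) (toℚ-suc-*-1/suc n)
    (*-monoʳ-≤-nonNeg (1/suc n) (1/suc-nonNeg n) a≤n+1)

  1≤-*-1/suc : ∀ {a} n → toℚ (suc n) ≤ a → 1ℚ ≤ a * 1/suc n
  1≤-*-1/suc {a} n n+1≤a = subst (_≤ a * 1/suc n) (toℚ-suc-*-1/suc n)
    (*-monoʳ-≤-nonNeg (1/suc n) (1/suc-nonNeg n) n+1≤a)

  expTerm-decreasing : ∀ {r} → 0ℚ ≤ r → ∀ n → r ≤ toℚ (suc n) → expTerm r (suc n) ≤ expTerm r n
  expTerm-decreasing {r} 0≤r n r≤n+1 rewrite expTerm-suc r n =
    *-≤-of-≤1 (expTerm-nonNeg 0≤r n) (*-1/suc-≤-1 n r≤n+1)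

  expTerm-increasing : ∀ {r} → 0ℚ ≤ r → ∀ n → toℚ (suc n) ≤ r → expTerm r n ≤ expTerm r (suc n)
  expTerm-increasing {r} 0≤r n n+1≤r rewrite expTerm-suc r n =
    ≤-*-of-1≤ (expTerm-nonNeg 0≤r n) (1≤-*-1/suc n n+1≤r)

  expTerm-halving : ∀ {r} → 0ℚ ≤ r → ∀ n → r + r ≤ toℚ (suc n) →
                    expTerm r (suc n) + expTerm r (suc n) ≤ expTerm r n
  expTerm-halving {r} 0≤r n 2r≤n+1 = subst (_≤ expTerm r n) (sym twice)
    (*-≤-of-≤1 (expTerm-nonNeg 0≤r n) (*-1/suc-≤-1 n 2r≤n+1))
    where
    twice : expTerm r (suc n) + expTerm r (suc n) ≡ expTerm r n * ((r + r) * 1/suc n)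
    twice = solve 3 (λ t r i → t :* r :* i :+ t :* r :* i := t :* ((r :+ r) :* i)) refl (expTerm r n) r (1/suc n)

  -- From index M on the terms at least halve at each step, so they add up to at most 2 T_M.
  expPartial-tail : ∀ {r} → 0ℚ ≤ r → ∀ M → r + r ≤ toℚ (suc M) → ∀ N →
                    expPartial r N ≤ expPartial r M + (expTerm r M + expTerm r M)
  expPartial-tail {r} 0≤r M 2r≤M+1 N = [ below , above ]′ (ℕ.≤-total N M)
    where
    Φ : ℕ → ℚ
    Φ n = expPartial r n + (expTerm r n + expTerm r n)
    Φ-step : ∀ {n} → M ℕ.≤ n → Φ (suc n) ≤ Φ n
    Φ-step {n} M≤n = subst (Φ (suc n) ≤_) (ℚ.+-assoc (expPartial r n) (expTerm r n) (expTerm r n))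
      (ℚ.+-monoʳ-≤ (expPartial r n + expTerm r n)
        (expTerm-halving 0≤r n (ℚ.≤-trans 2r≤M+1 (toℚ-mono-≤ (s≤s M≤n)))))
    twice-nonNeg : ∀ n → 0ℚ ≤ expTerm r n + expTerm r n
    twice-nonNeg n = ℚ.+-mono-≤ (expTerm-nonNeg 0≤r n) (expTerm-nonNeg 0≤r n)
    below : N ℕ.≤ M → expPartial r N ≤ Φ M
    below N≤M = ℚ.≤-trans (expPartial-monoʳ-≤ 0≤r N≤M)
      (≤-+-nonNeg (expPartial r M) (twice-nonNeg M))
    above : M ℕ.≤ N → expPartial r N ≤ Φ M
    above M≤N = ℚ.≤-trans (≤-+-nonNeg (expPartial r N) (twice-nonNeg N))
      (descending⇒≤ Φ Φ-step (ℕ.≤⇒≤′ M≤N))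

  expTerm≤expTerm-at : ∀ {r j} → toℚ j ≤ r → r ≤ toℚ (suc j) → ∀ n → expTerm r n ≤ expTerm r j
  expTerm≤expTerm-at {r} {j} j≤r r≤j+1 n = [ up , down ]′ (ℕ.≤-total n j)
    where
    0≤r : 0ℚ ≤ r
    0≤r = ℚ.≤-trans (toℚ-nonNeg j) j≤r
    up : n ℕ.≤ j → expTerm r n ≤ expTerm r j
    up n≤j = ascending⇒≤ (expTerm r)
      (λ {i} i<j → expTerm-increasing 0≤r i (ℚ.≤-trans (toℚ-mono-≤ i<j) j≤r)) (ℕ.≤⇒≤‴ n≤j)
    down : j ℕ.≤ n → expTerm r n ≤ expTerm r j
    down j≤n = descending⇒≤ (expTerm r)
      (λ {i} j≤i → expTerm-decreasing 0≤r i (ℚ.≤-trans r≤j+1 (toℚ-mono-≤ (s≤s j≤i))))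
      (ℕ.≤⇒≤′ j≤n)

  expPartial≤*bound : ∀ {r B} → (∀ n → expTerm r n ≤ B) → ∀ N → expPartial r N ≤ toℚ N * B
  expPartial≤*bound {r} {B} bound zero    = subst (0ℚ ≤_) (sym (ℚ.*-zeroˡ B)) ℚ.≤-refl
  expPartial≤*bound {r} {B} bound (suc N) = subst (expPartial r (suc N) ≤_) (sym unfold)
    (ℚ.+-mono-≤ (expPartial≤*bound bound N) (bound N))
    where
    unfold : toℚ (suc N) * B ≡ toℚ N * B + B
    unfold = trans (cong (_* B) (toℚ-+ 1 N))
      (solve 2 (λ n b → (con 1ℚ :+ n) :* b := n :* b :+ b) refl (toℚ N) B)

  n≤n! : ∀ n → n ℕ.≤ n !
  n≤n! zero    = z≤n
  n≤n! (suc n) = subst (ℕ._≤ suc n ℕ.* n !) (ℕ.*-identityʳ (suc n)) (ℕ.*-monoʳ-≤ (suc n) (ℕ.1≤n! n))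

  2j+3≤j*j! : ∀ {j} → 3 ℕ.≤ j → 2 ℕ.+ (j ℕ.+ suc j) ℕ.≤ j ℕ.* j !
  2j+3≤j*j! {j} 3≤j = begin
    2 ℕ.+ (j ℕ.+ suc j) ≡⟨ cong (2 ℕ.+_) (ℕ.+-suc j j) ⟩
    3 ℕ.+ (j ℕ.+ j)     ≤⟨ ℕ.+-monoˡ-≤ (j ℕ.+ j) 3≤j ⟩
    j ℕ.+ (j ℕ.+ j)     ≡⟨ cong (λ x → j ℕ.+ (j ℕ.+ x)) (ℕ.+-identityʳ j) ⟨
    3 ℕ.* j             ≡⟨ ℕ.*-comm 3 j ⟩
    j ℕ.* 3             ≤⟨ ℕ.*-monoʳ-≤ j (ℕ.≤-trans 3≤j (n≤n! j)) ⟩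
    j ℕ.* j !           ∎
    where open ℕ.≤-Reasoning

  -- On [j, j+1] the j-th term T_j is the largest, and (2j+3)·T_j ≤ j·j!·T_j ≤ r·r^j.
  expPartial≤qpow : ∀ {r j} → 3 ℕ.≤ j → toℚ j ≤ r → r ≤ toℚ (suc j) →
                    ∀ N → expPartial r N ≤ qpow r (suc j)
  expPartial≤qpow {r} {j} 3≤j j≤r r≤j+1 N = begin
    expPartial r N                   ≤⟨ expPartial-tail 0≤r M 2r≤M+1 N ⟩
    expPartial r M + (T M + T M)     ≤⟨ ℚ.+-mono-≤ (expPartial≤*bound max M) (ℚ.+-mono-≤ (max M) (max M)) ⟩
    toℚ M * Tⱼ + (Tⱼ + Tⱼ)           ≡⟨ collect ⟩
    toℚ (2 ℕ.+ M) * Tⱼ               ≤⟨ *-monoʳ-≤-nonNeg Tⱼ (expTerm-nonNeg 0≤r j) 2j+3≤r*j! ⟩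
    r * toℚ (j !) * Tⱼ               ≡⟨ ℚ.*-assoc r (toℚ (j !)) Tⱼ ⟩
    r * (toℚ (j !) * Tⱼ)             ≡⟨ cong (r *_) (ℚ.*-comm (toℚ (j !)) Tⱼ) ⟩
    r * (Tⱼ * toℚ (j !))             ≡⟨ cong (r *_) (expTerm-*-! r j) ⟩
    qpow r (suc j)                   ∎
    where
    open ℚ.≤-Reasoning
    T : ℕ → ℚ
    T = expTerm r
    Tⱼ : ℚ
    Tⱼ = T j
    M : ℕ
    M = j ℕ.+ suc j
    0≤r : 0ℚ ≤ r
    0≤r = ℚ.≤-trans (toℚ-nonNeg j) j≤r
    max : ∀ n → T n ≤ Tⱼ
    max = expTerm≤expTerm-at {j = j} j≤r r≤j+1
    2r≤M+1 : r + r ≤ toℚ (suc M)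
    2r≤M+1 = subst (r + r ≤_) (sym (toℚ-+ (suc j) (suc j))) (ℚ.+-mono-≤ r≤j+1 r≤j+1)
    collect : toℚ M * Tⱼ + (Tⱼ + Tⱼ) ≡ toℚ (2 ℕ.+ M) * Tⱼ
    collect = trans (solve 2 (λ m t → m :* t :+ (t :+ t) := (con 1ℚ :+ con 1ℚ :+ m) :* t) refl (toℚ M) Tⱼ)
                    (cong (_* Tⱼ) (trans (cong (_+ toℚ M) (sym (toℚ-+ 1 1))) (sym (toℚ-+ 2 M))))
    2j+3≤r*j! : toℚ (2 ℕ.+ M) ≤ r * toℚ (j !)
    2j+3≤r*j! = ℚ.≤-trans (toℚ-mono-≤ (2j+3≤j*j! 3≤j))
      (subst (_≤ r * toℚ (j !)) (sym (toℚ-* j (j !)))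
        (*-monoʳ-≤-nonNeg (toℚ (j !)) (toℚ-nonNeg (j !)) j≤r))

  expPartial-bounded : ∀ c U M → 0ℚ ≤ c → c + c ≤ toℚ (suc M) →
                       expPartial c M + (expTerm c M + expTerm c M) ≤ U → ∀ N → expPartial c N ≤ U
  expPartial-bounded c U M 0≤c 2c≤M+1 tail≤U N = ℚ.≤-trans (expPartial-tail 0≤c M 2c≤M+1 N) tail≤U

  bootstrap-step : ∀ {k p r N} c U c′ → 4 ℕ.≤ k → 0ℚ ≤ r → 1ℚ ≤ c′ → r ≤ c →
                   (∀ N → expPartial c N ≤ U) → U ≤ qpow c′ 4 →
                   qpow r k ≤ toℚ p → toℚ p < expPartial r N → r < c′
  bootstrap-step {k} {p} {r} {N} c U c′ 4≤k 0≤r 1≤c′ r≤c E≤U U≤c′⁴ rᵏ≤p p<E with c′ ℚ.≤? r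
  ... | no c′≰r = ℚ.≰⇒> c′≰r
  ... | yes c′≤r = ⊥-elim (ℚ.<-irrefl refl (begin-strict
    qpow c′ k       ≤⟨ qpow-monoˡ-≤ (ℚ.≤-trans (toℚ-nonNeg 1) 1≤c′) c′≤r k ⟩
    qpow r k        ≤⟨ rᵏ≤p ⟩
    toℚ p           <⟨ p<E ⟩
    expPartial r N  ≤⟨ expPartial-monoˡ-≤ 0≤r r≤c N ⟩
    expPartial c N  ≤⟨ E≤U N ⟩
    U               ≤⟨ U≤c′⁴ ⟩
    qpow c′ 4       ≤⟨ qpow-monoʳ-≤ 1≤c′ 4≤k ⟩
    qpow c′ k       ∎))
    where open ℚ.≤-Reasoning

  -- Alternating p < e^r and r^4 ≤ p: r ≤ 3 ⇒ r < 2.12 ⇒ r < 1.7 ⇒ r < 1.54 ⇒ p < e^1.54 < 5.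
  no-solution-below-3 : ∀ {k p r N} → 4 ℕ.≤ k → 5 ℕ.≤ p → 0ℚ ≤ r → r ≤ toℚ 3 →
                        qpow r k ≤ toℚ p → ¬ (toℚ p < expPartial r N)
  no-solution-below-3 {k} {p} {r} {N} 4≤k 5≤p 0≤r r≤3 rᵏ≤p p<E = ℚ.<-irrefl refl (begin-strict
    toℚ p           <⟨ p<E ⟩
    expPartial r N  ≤⟨ expPartial-monoˡ-≤ 0≤r (ℚ.<⇒≤ r<c₃) N ⟩
    expPartial c₃ N ≤⟨ E≤U₃ N ⟩
    U₃              ≤⟨ ℚ.≤ᵇ⇒≤ tt ⟩
    toℚ 5           ≤⟨ toℚ-mono-≤ 5≤p ⟩
    toℚ p           ∎)
    where
    open ℚ.≤-Reasoning
    c₀ c₁ c₂ c₃ U₀ U₁ U₂ U₃ : ℚ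
    c₀ = toℚ 3
    c₁ = + 212 ℚ./ 100
    c₂ = + 17 ℚ./ 10
    c₃ = + 154 ℚ./ 100
    U₀ = + 201 ℚ./ 10
    U₁ = + 834 ℚ./ 100
    U₂ = + 548 ℚ./ 100
    U₃ = + 467 ℚ./ 100
    E≤U₀ : ∀ N → expPartial c₀ N ≤ U₀
    E≤U₀ = expPartial-bounded c₀ U₀ 14 (ℚ.≤ᵇ⇒≤ tt) (ℚ.≤ᵇ⇒≤ tt) (ℚ.≤ᵇ⇒≤ tt)
    E≤U₁ : ∀ N → expPartial c₁ N ≤ U₁
    E≤U₁ = expPartial-bounded c₁ U₁ 14 (ℚ.≤ᵇ⇒≤ tt) (ℚ.≤ᵇ⇒≤ tt) (ℚ.≤ᵇ⇒≤ tt)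
    E≤U₂ : ∀ N → expPartial c₂ N ≤ U₂
    E≤U₂ = expPartial-bounded c₂ U₂ 14 (ℚ.≤ᵇ⇒≤ tt) (ℚ.≤ᵇ⇒≤ tt) (ℚ.≤ᵇ⇒≤ tt)
    E≤U₃ : ∀ N → expPartial c₃ N ≤ U₃
    E≤U₃ = expPartial-bounded c₃ U₃ 14 (ℚ.≤ᵇ⇒≤ tt) (ℚ.≤ᵇ⇒≤ tt) (ℚ.≤ᵇ⇒≤ tt)
    step : ∀ {c} c′ U → r ≤ c → (∀ N → expPartial c N ≤ U) → U ≤ qpow c′ 4 → 1ℚ ≤ c′ → r < c′
    step {c} c′ U r≤c E≤U U≤c′⁴ 1≤c′ =
      bootstrap-step {k} {p} {r} {N} c U c′ 4≤k 0≤r 1≤c′ r≤c E≤U U≤c′⁴ rᵏ≤p p<E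
    r<c₁ : r < c₁
    r<c₁ = step c₁ U₀ r≤3 E≤U₀ (ℚ.≤ᵇ⇒≤ tt) (ℚ.≤ᵇ⇒≤ tt)
    r<c₂ : r < c₂
    r<c₂ = step c₂ U₁ (ℚ.<⇒≤ r<c₁) E≤U₁ (ℚ.≤ᵇ⇒≤ tt) (ℚ.≤ᵇ⇒≤ tt)
    r<c₃ : r < c₃
    r<c₃ = step c₃ U₂ (ℚ.<⇒≤ r<c₂) E≤U₂ (ℚ.≤ᵇ⇒≤ tt) (ℚ.≤ᵇ⇒≤ tt)

  floor-bracket : ∀ {r} → 0ℚ ≤ r → ∀ n → r < toℚ n →
                  ∃[ j ] (j ℕ.< n × toℚ j ≤ r × r < toℚ (suc j))
  floor-bracket 0≤r zero    r<0 = ⊥-elim (ℚ.<-irrefl refl (ℚ.≤-<-trans 0≤r r<0))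
  floor-bracket {r} 0≤r (suc n) r<n+1 with toℚ n ℚ.≤? r
  ... | yes n≤r = n , ℕ.≤-refl , n≤r , r<n+1
  ... | no n≰r with j , j<n , j≤r<j+1 ← floor-bracket 0≤r n (ℚ.≰⇒> n≰r) =
    j , ℕ.m≤n⇒m≤1+n j<n , j≤r<j+1

  LogBound⇒^≤ : ∀ {p k} → 5 ℕ.≤ p → 4 ℕ.≤ k → LogBound p k → k ℕ.^ k ℕ.≤ p
  LogBound⇒^≤ {p} {k} 5≤p 4≤k (_ , r , 0≤r , rᵏ≤p , N , p<E) = toℚ-cancel-≤ (begin
    toℚ (k ℕ.^ k)  ≡⟨ qpow-toℚ k k ⟨
    qpow (toℚ k) k ≤⟨ qpow-monoˡ-≤ (toℚ-nonNeg k) k≤r k ⟩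
    qpow r k       ≤⟨ rᵏ≤p ⟩
    toℚ p          ∎)
    where
    open ℚ.≤-Reasoning
    k≤r : toℚ k ≤ r
    k≤r with toℚ k ℚ.≤? r
    ... | yes k≤r = k≤r
    ... | no k≰r with j , j<k , j≤r , r<j+1 ← floor-bracket 0≤r k (ℚ.≰⇒> k≰r) with 3 ℕ.≤? j
    ...   | no 3≰j = ⊥-elim (no-solution-below-3 {k} {p} {r} {N} 4≤k 5≤p 0≤r r≤3 rᵏ≤p p<E)
      where
      r≤3 : r ≤ toℚ 3
      r≤3 = ℚ.≤-trans (ℚ.<⇒≤ r<j+1) (toℚ-mono-≤ (ℕ.≰⇒> 3≰j))
    ...   | yes 3≤j = ⊥-elim (ℚ.<-irrefl refl (begin-strict
      toℚ p          <⟨ p<E ⟩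
      expPartial r N ≤⟨ expPartial≤qpow {r} {j} 3≤j j≤r (ℚ.<⇒≤ r<j+1) N ⟩
      qpow r (suc j) ≤⟨ qpow-monoʳ-≤ 1≤r j<k ⟩
      qpow r k       ≤⟨ rᵏ≤p ⟩
      toℚ p          ∎))
      where
      1≤r : 1ℚ ≤ r
      1≤r = ℚ.≤-trans (toℚ-mono-≤ {1} {j} (ℕ.≤-trans (s≤s z≤n) 3≤j)) j≤r

module Congruences where

  open import Data.Nat as ℕ using (ℕ; zero; suc; NonZero)
  import Data.Nat.Properties as ℕ
  open import Data.Nat.DivMod using (_%_; _/_; m≡m%n+[m/n]*n)
  import Data.Nat.Divisibility as ℕ
  open import Data.Nat.Primality using (Prime; euclidsLemma)
  open import Data.Integer as ℤ using (ℤ; +_; 0ℤ; _+_; _-_; -_; _*_; ∣_∣)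
  import Data.Integer.Properties as ℤ
  open import Data.Integer.Divisibility.Signed
    using (_∣_; divides; ∣ᵤ⇒∣; ∣⇒∣ᵤ; ∣m∣n⇒∣m+n; ∣m⇒∣-m; ∣n⇒∣m*n)
  open import Data.Integer.Tactic.RingSolver using (solve-∀)
  open import Data.Sum using (inj₁; inj₂)
  open import Data.Empty using (⊥-elim)
  open import Relation.Nullary using (¬_)
  open import Relation.Binary.PropositionalEquality
    using (_≡_; refl; sym; trans; cong; subst; module ≡-Reasoning)

  infix 4 _≡_mod_

  record _≡_mod_ (i j : ℤ) (p : ℕ) : Set where
    constructor ≡-mod
    field p∣i-j : + p ∣ i - j

  open _≡_mod_ public

  module _ {p : ℕ} where

    ≡-mod-refl : ∀ i → i ≡ i mod p
    ≡-mod-refl i = ≡-mod (divides 0ℤ (trans (ℤ.+-inverseʳ i) (sym (ℤ.*-zeroˡ (+ p)))))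

    ≡-mod-sym : ∀ {i j} → i ≡ j mod p → j ≡ i mod p
    ≡-mod-sym {i} {j} (≡-mod p∣i-j) = ≡-mod (subst (+ p ∣_) (flip i j) (∣m⇒∣-m p∣i-j))
      where
      flip : ∀ i j → - (i - j) ≡ j - i
      flip = solve-∀

    ≡-mod-trans : ∀ {i j k} → i ≡ j mod p → j ≡ k mod p → i ≡ k mod p
    ≡-mod-trans {i} {j} {k} (≡-mod p∣i-j) (≡-mod p∣j-k) =
      ≡-mod (subst (+ p ∣_) (telescope i j k) (∣m∣n⇒∣m+n p∣i-j p∣j-k))
      where
      telescope : ∀ i j k → (i - j) + (j - k) ≡ i - k
      telescope = solve-∀

    +-cong-mod : ∀ {a b c d} → a ≡ b mod p → c ≡ d mod p → a + c ≡ b + d mod p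
    +-cong-mod {a} {b} {c} {d} (≡-mod p∣a-b) (≡-mod p∣c-d) =
      ≡-mod (subst (+ p ∣_) (regroup a b c d) (∣m∣n⇒∣m+n p∣a-b p∣c-d))
      where
      regroup : ∀ a b c d → (a - b) + (c - d) ≡ (a + c) - (b + d)
      regroup = solve-∀

    -‿cong-mod : ∀ {a b c d} → a ≡ b mod p → c ≡ d mod p → a - c ≡ b - d mod p
    -‿cong-mod {a} {b} {c} {d} (≡-mod p∣a-b) (≡-mod p∣c-d) =
      ≡-mod (subst (+ p ∣_) (regroup a b c d) (∣m∣n⇒∣m+n p∣a-b (∣m⇒∣-m p∣c-d)))
      where
      regroup : ∀ a b c d → (a - b) + - (c - d) ≡ (a - c) - (b - d)
      regroup = solve-∀

    *-congˡ-mod : ∀ c {a b} → a ≡ b mod p → c * a ≡ c * b mod p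
    *-congˡ-mod c {a} {b} (≡-mod p∣a-b) = ≡-mod (subst (+ p ∣_) (distrib c a b) (∣n⇒∣m*n c p∣a-b))
      where
      distrib : ∀ c a b → c * (a - b) ≡ c * a - c * b
      distrib = solve-∀

    ≡-mod⇒≡ : ∀ {i j} → i ≡ j mod p → ∣ i - j ∣ ℕ.< p → i ≡ j
    ≡-mod⇒≡ {i} {j} (≡-mod p∣i-j) close with ∣ i - j ∣ in eq
    ... | zero  = ℤ.i-j≡0⇒i≡j i j (ℤ.∣i∣≡0⇒i≡0 eq)
    ... | suc n = ⊥-elim (ℕ.<-irrefl refl (ℕ.<-≤-trans close
                    (ℕ.∣⇒≤ (subst (p ℕ.∣_) eq (∣⇒∣ᵤ p∣i-j)))))

    ∣residue-residue∣<p : ∀ {a b} → a ℕ.< p → b ℕ.< p → ∣ + a - + b ∣ ℕ.< p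
    ∣residue-residue∣<p {a} {b} a<p b<p = subst (ℕ._< p) (cong ∣_∣ (sym (ℤ.m-n≡m⊖n a b)))
      (ℕ.≤-<-trans (ℤ.∣m⊝n∣≤m⊔n a b) (ℕ.⊔-pres-<m a<p b<p))

    residues-≡-mod⇒≡ : ∀ {a b} → + a ≡ + b mod p → a ℕ.< p → b ℕ.< p → a ≡ b
    residues-≡-mod⇒≡ a≡b a<p b<p = ℤ.+-injective (≡-mod⇒≡ a≡b (∣residue-residue∣<p a<p b<p))

    *-cancelˡ-mod : Prime p → ∀ {c a b} → ¬ (c ≡ 0ℤ mod p) → c * a ≡ c * b mod p → a ≡ b mod p
    *-cancelˡ-mod p-prime {c} {a} {b} c≢0 (≡-mod p∣ca-cb)
      with euclidsLemma ∣ c ∣ ∣ a - b ∣ p-prime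
             (subst (p ℕ.∣_) (trans (cong ∣_∣ (distrib c a b)) (ℤ.abs-* c (a - b))) (∣⇒∣ᵤ p∣ca-cb))
      where
      distrib : ∀ c a b → c * a - c * b ≡ c * (a - b)
      distrib = solve-∀
    ... | inj₁ p∣c   = ⊥-elim (c≢0 (≡-mod (subst (+ p ∣_) (sym (ℤ.+-identityʳ c)) (∣ᵤ⇒∣ p∣c))))
    ... | inj₂ p∣a-b = ≡-mod (∣ᵤ⇒∣ p∣a-b)

  module _ {p : ℕ} .{{_ : NonZero p}} where

    +-rem+quot : ∀ n → + n ≡ + (n % p) + + (n / p) * + p
    +-rem+quot n = trans (cong +_ (m≡m%n+[m/n]*n n p))
      (trans (ℤ.pos-+ (n % p) (n / p ℕ.* p)) (cong (_+_ (+ (n % p))) (ℤ.pos-* (n / p) p)))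

    %-≡-mod : ∀ n → + (n % p) ≡ + n mod p
    %-≡-mod n = ≡-mod (divides (- + (n / p))
      (trans (cong (_-_ (+ (n % p))) (+-rem+quot n)) (cancel (+ (n % p)) (+ (n / p)) (+ p))))
      where
      cancel : ∀ r q p → r - (r + q * p) ≡ - q * p
      cancel = solve-∀

    %≡%⇒≡-mod : ∀ {m n} → m % p ≡ n % p → + m ≡ + n mod p
    %≡%⇒≡-mod {m} {n} eq = ≡-mod-trans (≡-mod-sym (%-≡-mod m))
      (subst (λ r → + r ≡ + n mod p) (sym eq) (%-≡-mod n))

    nonzero-residue : ∀ {a} → 0 ℕ.< a → a ℕ.< p → ¬ (+ a ≡ 0ℤ mod p)
    nonzero-residue 0<a a<p a≡0 = ℕ.<-irrefl (sym (residues-≡-mod⇒≡ a≡0 a<p (ℕ.>-nonZero⁻¹ p))) 0<a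

module Dirichlet where

  open Congruences
  open import Data.Nat as ℕ using (ℕ; NonZero; _^_)
  import Data.Nat.Properties as ℕ
  open import Data.Nat.DivMod using (_%_; _/_; m%n<n; m<n*o⇒m/o<n)
  open import Data.Integer as ℤ using (ℤ; +_; _+_; _-_; _*_; ∣_∣)
  import Data.Integer.Properties as ℤ
  open import Data.Integer.Tactic.RingSolver using (solve-∀)
  open import Data.Fin as Fin using (Fin; toℕ; fromℕ<; funToFin; finToFun)
  import Data.Fin.Properties as Fin
  open import Data.List using (List; length; lookup)
  import Data.List.Properties as List
  open import Data.List.Relation.Unary.All using (All)
  import Data.List.Relation.Unary.All.Properties as All
  open import Data.Product using (_×_; _,_; ∃₂)
  open import Relation.Binary.PropositionalEquality
    using (_≡_; sym; trans; cong; cong₂; subst; module ≡-Reasoning)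

  module _ {p m : ℕ} .{{_ : NonZero p}} .{{_ : NonZero m}} where

    bucket : ℕ → ℕ
    bucket x = (x % p ℕ.* m) / p

    bucket<m : ∀ x → bucket x ℕ.< m
    bucket<m x = m<n*o⇒m/o<n (subst (x % p ℕ.* m ℕ.<_) (ℕ.*-comm p m) (ℕ.*-monoˡ-< m (m%n<n x p)))

    same-bucket⇒close : ∀ x y → bucket x ≡ bucket y → ∣ + (x % p) - + (y % p) ∣ ℕ.* m ℕ.< p
    same-bucket⇒close x y same =
      subst (ℕ._< p) (sym distance) (∣residue-residue∣<p (m%n<n X p) (m%n<n Y p))
      where
      open ≡-Reasoning
      X Y : ℕ
      X = x % p ℕ.* m
      Y = y % p ℕ.* m
      scale : ∀ a b m → (a - b) * m ≡ a * m - b * m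
      scale = solve-∀
      cancel : ∀ r s q → (r + q) - (s + q) ≡ r - s
      cancel = solve-∀
      distance : ∣ + (x % p) - + (y % p) ∣ ℕ.* m ≡ ∣ + (X % p) - + (Y % p) ∣
      distance = begin
        ∣ + (x % p) - + (y % p) ∣ ℕ.* m
          ≡⟨ ℤ.abs-* (+ (x % p) - + (y % p)) (+ m) ⟨
        ∣ (+ (x % p) - + (y % p)) * + m ∣
          ≡⟨ cong ∣_∣ (scale (+ (x % p)) (+ (y % p)) (+ m)) ⟩
        ∣ + (x % p) * + m - + (y % p) * + m ∣
          ≡⟨ cong ∣_∣ (cong₂ _-_ (ℤ.pos-* (x % p) m) (ℤ.pos-* (y % p) m)) ⟨
        ∣ + X - + Y ∣
          ≡⟨ cong ∣_∣ (cong₂ _-_ (+-rem+quot {p} X) (+-rem+quot {p} Y)) ⟩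
        ∣ (+ (X % p) + + (X / p) * + p) - (+ (Y % p) + + (Y / p) * + p) ∣
          ≡⟨ cong (λ q → ∣ (+ (X % p) + + q * + p) - (+ (Y % p) + + (Y / p) * + p) ∣) same ⟩
        ∣ (+ (X % p) + + (Y / p) * + p) - (+ (Y % p) + + (Y / p) * + p) ∣
          ≡⟨ cong ∣_∣ (cancel (+ (X % p)) (+ (Y % p)) (+ (Y / p) * + p)) ⟩
        ∣ + (X % p) - + (Y % p) ∣ ∎

    bucket-code : (A : List ℕ) → Fin p → Fin (m ^ length A)
    bucket-code A l = funToFin (λ i → fromℕ< (bucket<m (toℕ l ℕ.* lookup A i)))

    dirichlet : (A : List ℕ) → m ^ length A ℕ.< p → ∃₂ λ l₁ l₂ → l₁ ℕ.< l₂ × l₂ ℕ.< p ×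
                All (λ a → ∣ + ((l₂ ℕ.* a) % p) - + ((l₁ ℕ.* a) % p) ∣ ℕ.* m ℕ.< p) A
    dirichlet A mᵏ<p with l₁ , l₂ , l₁<l₂ , same-code ← Fin.pigeonhole mᵏ<p (bucket-code A) =
      toℕ l₁ , toℕ l₂ , l₁<l₂ , Fin.toℕ<n l₂ ,
      subst (All _) (List.tabulate-lookup A) (All.tabulate⁺ (λ i →
        same-bucket⇒close (toℕ l₂ ℕ.* lookup A i) (toℕ l₁ ℕ.* lookup A i) (sym (same-bucket i))))
      where
      same-bucket : ∀ i → bucket (toℕ l₁ ℕ.* lookup A i) ≡ bucket (toℕ l₂ ℕ.* lookup A i)
      same-bucket i = trans (sym (Fin.toℕ-fromℕ< (bucket<m _))) (trans (cong toℕ (begin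
        fromℕ< (bucket<m (toℕ l₁ ℕ.* lookup A i)) ≡⟨ Fin.finToFun-funToFin _ i ⟨
        finToFun (bucket-code A l₁) i             ≡⟨ cong (λ c → finToFun c i) same-code ⟩
        finToFun (bucket-code A l₂) i             ≡⟨ Fin.finToFun-funToFin _ i ⟩
        fromℕ< (bucket<m (toℕ l₂ ℕ.* lookup A i)) ∎)) (Fin.toℕ-fromℕ< (bucket<m _)))
        where open ≡-Reasoning

module IntegerOrderings where

  open Lists
  open import Data.Nat as ℕ using (ℕ; zero; suc)
  import Data.Nat.Properties as ℕ
  open import Data.Integer as ℤ using (ℤ; 0ℤ; _+_; _-_; -_; _<_; _≤_)
  import Data.Integer.Properties as ℤ
  open import Data.Integer.Tactic.RingSolver using (solve-∀)
  open import Algebra.Properties.AbelianGroup ℤ.+-0-abelianGroup using (∙-cancelˡ)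
  open import Data.List using (List; []; _∷_; _∷ʳ_; [_]; map; foldr; reverse; length)
  import Data.List.Properties as List
  open import Data.List.Relation.Unary.All as All using (All; []; _∷_)
  import Data.List.Relation.Unary.All.Properties as All
  open import Data.List.Relation.Unary.Any using (any?)
  open import Data.List.Relation.Unary.AllPairs using ([]; _∷_)
  open import Data.List.Relation.Unary.Unique.Propositional using (Unique)
  import Data.List.Relation.Unary.Unique.Propositional.Properties as Unique
  open import Data.List.Relation.Binary.Permutation.Propositional
    using (_↭_; ↭-refl; ↭-sym; ↭-trans; ↭-prep; ↭⇒↭ₛ)
  open import Data.List.Relation.Binary.Permutation.Propositional.Properties
    using (All-resp-↭; ↭-map-inv; ↭-length; ↭-reverse)
  import Data.List.Relation.Binary.Permutation.Setoid.Properties as Permutationₛ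
  open import Data.Product using (_×_; _,_; ∃-syntax)
  open import Data.Empty using (⊥-elim)
  open import Function using (_∘_)
  open import Relation.Nullary using (¬_; yes; no; ¬?)
  open import Relation.Nullary.Decidable using (_×-dec_)
  open import Relation.Binary.Definitions using (Tri; tri<; tri≈; tri>)
  open import Relation.Binary.PropositionalEquality
    using (_≡_; _≢_; refl; sym; trans; cong; cong₂; subst; subst₂; setoid; ≢-sym; module ≡-Reasoning)

  +-cancelˡ-< : ∀ x {s t} → x + s < x + t → s < t
  +-cancelˡ-< x {s} {t} x+s<x+t = subst₂ _<_ (cancel x s) (cancel x t) (ℤ.+-monoʳ-< (- x) x+s<x+t)
    where
    cancel : ∀ x u → - x + (x + u) ≡ u
    cancel = solve-∀

  ∑ : List ℤ → ℤ
  ∑ = foldr _+_ 0ℤ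

  sums : List ℤ → List ℤ
  sums []       = []
  sums (x ∷ xs) = x ∷ map (x +_) (sums xs)

  ∑-↭ : ∀ {xs ys} → xs ↭ ys → ∑ xs ≡ ∑ ys
  ∑-↭ xs↭ys = Permutationₛ.foldr-commMonoid (setoid ℤ) ℤ.+-0-isCommutativeMonoid (↭⇒↭ₛ xs↭ys)

  ∑-neg : ∀ xs → ∑ (map -_ xs) ≡ - ∑ xs
  ∑-neg []       = refl
  ∑-neg (x ∷ xs) = trans (cong (- x +_) (∑-neg xs)) (sym (ℤ.neg-distrib-+ x (∑ xs)))

  ∑-nonPos : ∀ {xs} → All (_≤ 0ℤ) xs → ∑ xs ≤ 0ℤ
  ∑-nonPos []         = ℤ.≤-refl
  ∑-nonPos (x≤0 ∷ xs) = ℤ.+-mono-≤ x≤0 (∑-nonPos xs)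

  ∑-negative : ∀ {x xs} → All (_< 0ℤ) (x ∷ xs) → ∑ (x ∷ xs) < 0ℤ
  ∑-negative (x<0 ∷ xs<0) = ℤ.+-mono-<-≤ x<0 (∑-nonPos (All.map ℤ.<⇒≤ xs<0))

  sums-neg : ∀ xs → sums (map -_ xs) ≡ map -_ (sums xs)
  sums-neg []       = refl
  sums-neg (x ∷ xs) = cong (- x ∷_) (begin
    map (- x +_) (sums (map -_ xs)) ≡⟨ cong (map (- x +_)) (sums-neg xs) ⟩
    map (- x +_) (map -_ (sums xs)) ≡⟨ List.map-∘ (sums xs) ⟨
    map (λ s → - x + - s) (sums xs) ≡⟨ List.map-cong (λ s → sym (ℤ.neg-distrib-+ x s)) (sums xs) ⟩
    map (λ s → - (x + s)) (sums xs) ≡⟨ List.map-∘ (sums xs) ⟩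
    map -_ (map (x +_) (sums xs))   ∎)
    where open ≡-Reasoning

  sums-∷ : ∀ x xs → sums (x ∷ xs) ≡ map (x +_) (0ℤ ∷ sums xs)
  sums-∷ x xs = cong (_∷ map (x +_) (sums xs)) (sym (ℤ.+-identityʳ x))

  sums-∷ʳ : ∀ xs y → sums (xs ∷ʳ y) ≡ sums xs ∷ʳ (∑ xs + y)
  sums-∷ʳ []       y = cong [_] (sym (ℤ.+-identityˡ y))
  sums-∷ʳ (x ∷ xs) y = cong (x ∷_) (begin
    map (x +_) (sums (xs ∷ʳ y))              ≡⟨ cong (map (x +_)) (sums-∷ʳ xs y) ⟩
    map (x +_) (sums xs ∷ʳ (∑ xs + y))       ≡⟨ List.map-++ (x +_) (sums xs) _ ⟩
    map (x +_) (sums xs) ∷ʳ (x + (∑ xs + y)) ≡⟨ cong (map (x +_) (sums xs) ∷ʳ_) (sym (ℤ.+-assoc x (∑ xs) y)) ⟩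
    map (x +_) (sums xs) ∷ʳ (x + ∑ xs + y)   ∎)
    where open ≡-Reasoning

  sums-reverse : ∀ xs → 0ℤ ∷ sums (reverse xs) ≡ reverse (map (_-_ (∑ xs)) (0ℤ ∷ sums xs))
  sums-reverse []       = refl
  sums-reverse (x ∷ xs) = begin
    0ℤ ∷ sums (reverse (x ∷ xs))
      ≡⟨ cong (λ ys → 0ℤ ∷ sums ys) (List.unfold-reverse x xs) ⟩
    0ℤ ∷ sums (reverse xs ∷ʳ x)
      ≡⟨ cong (0ℤ ∷_) (sums-∷ʳ (reverse xs) x) ⟩
    (0ℤ ∷ sums (reverse xs)) ∷ʳ (∑ (reverse xs) + x)
      ≡⟨ cong₂ _∷ʳ_ (sums-reverse xs) (cong (_+ x) (∑-↭ (↭-reverse xs))) ⟩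
    reverse (map (_-_ (∑ xs)) (0ℤ ∷ sums xs)) ∷ʳ (∑ xs + x)
      ≡⟨ cong₂ (λ ys y → reverse ys ∷ʳ y) shifted
               (trans (ℤ.+-comm (∑ xs) x) (sym (ℤ.+-identityʳ (x + ∑ xs)))) ⟩
    reverse (map (_-_ (x + ∑ xs)) (x ∷ map (x +_) (sums xs))) ∷ʳ (x + ∑ xs - 0ℤ)
      ≡⟨ List.unfold-reverse (x + ∑ xs - 0ℤ) (map (_-_ (x + ∑ xs)) (x ∷ map (x +_) (sums xs))) ⟨
    reverse (map (_-_ (∑ (x ∷ xs))) (0ℤ ∷ sums (x ∷ xs))) ∎
    where
    open ≡-Reasoning
    head-eq : ∀ x t → t - 0ℤ ≡ (x + t) - x
    head-eq = solve-∀
    tail-eq : ∀ x t s → t - s ≡ (x + t) - (x + s)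
    tail-eq = solve-∀
    shifted : map (_-_ (∑ xs)) (0ℤ ∷ sums xs) ≡ map (_-_ (x + ∑ xs)) (x ∷ map (x +_) (sums xs))
    shifted = cong₂ _∷_ (head-eq x (∑ xs))
      (trans (List.map-cong (tail-eq x (∑ xs)) (sums xs)) (List.map-∘ (sums xs)))

  sums-∷-reverse : ∀ x xs → sums (x ∷ reverse xs) ↭ map (_-_ (x + ∑ xs)) (0ℤ ∷ sums xs)
  sums-∷-reverse x xs = subst (_↭ map (_-_ (x + ∑ xs)) (0ℤ ∷ sums xs)) (sym reversed) (↭-reverse _)
    where
    open ≡-Reasoning
    reversed : sums (x ∷ reverse xs) ≡ reverse (map (_-_ (x + ∑ xs)) (0ℤ ∷ sums xs))
    reversed = begin
      sums (x ∷ reverse xs)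
        ≡⟨ sums-∷ x (reverse xs) ⟩
      map (x +_) (0ℤ ∷ sums (reverse xs))
        ≡⟨ cong (map (x +_)) (sums-reverse xs) ⟩
      map (x +_) (reverse (map (_-_ (∑ xs)) (0ℤ ∷ sums xs)))
        ≡⟨ List.reverse-map (x +_) (map (_-_ (∑ xs)) (0ℤ ∷ sums xs)) ⟩
      reverse (map (x +_) (map (_-_ (∑ xs)) (0ℤ ∷ sums xs)))
        ≡⟨ cong reverse (List.map-∘ (0ℤ ∷ sums xs)) ⟨
      reverse (map (λ u → x + (∑ xs - u)) (0ℤ ∷ sums xs))
        ≡⟨ cong reverse (List.map-cong (λ u → sym (ℤ.+-assoc x (∑ xs) (- u))) (0ℤ ∷ sums xs)) ⟩
      reverse (map (_-_ (x + ∑ xs)) (0ℤ ∷ sums xs)) ∎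

  ValidOrdering : (ℤ → Set) → List ℤ → Set
  ValidOrdering P xs = ∃[ ys ] (ys ↭ xs × All P (sums ys) × Unique (sums ys))

  ValidOrdering-resp-↭ : ∀ {P xs ys} → xs ↭ ys → ValidOrdering P xs → ValidOrdering P ys
  ValidOrdering-resp-↭ xs↭ys (zs , zs↭xs , all , unique) = zs , ↭-trans zs↭xs xs↭ys , all , unique

  ValidOrdering-mono : ∀ {P Q : ℤ → Set} {xs} → (∀ {s} → P s → Q s) → ValidOrdering P xs → ValidOrdering Q xs
  ValidOrdering-mono P⇒Q (ys , ys↭xs , all , unique) = ys , ys↭xs , All.map P⇒Q all , unique

  ValidOrdering-neg : ∀ {xs} → ValidOrdering (0ℤ <_) (map -_ xs) → ValidOrdering (_< 0ℤ) xs
  ValidOrdering-neg (ys , ys↭ , positive , unique)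
    with zs , refl , xs↭zs ← ↭-map-inv -_ (↭-sym ys↭) rewrite sums-neg zs =
    zs , ↭-sym xs↭zs , All.map (λ {s} → ℤ.neg-cancel-< {0ℤ} {s}) (All.map⁻ positive) , Unique.map⁻ unique

  prepend-Unique : ∀ x {xs} → All (_≢ 0ℤ) (sums xs) → Unique (sums xs) → Unique (sums (x ∷ xs))
  prepend-Unique x ≢0 unique =
    All.map⁺ (All.map (λ s≢0 x≡x+s → s≢0 (sym (∙-cancelˡ x 0ℤ _ (trans (ℤ.+-identityʳ x) x≡x+s)))) ≢0)
    ∷ Unique.map⁺ (∙-cancelˡ x _ _) unique

  prepend-positive : ∀ {x rest} → 0ℤ < x → ValidOrdering (0ℤ <_) rest → ValidOrdering (0ℤ <_) (x ∷ rest)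
  prepend-positive {x} 0<x (ys , ys↭ , positive , unique) =
    x ∷ ys , ↭-prep x ys↭ , 0<x ∷ All.map⁺ (All.map (ℤ.+-mono-< 0<x) positive) ,
    prepend-Unique x (All.map (≢-sym ∘ ℤ.<⇒≢) positive) unique

  prepend-reversed : ∀ {x rest} → 0ℤ < x + ∑ rest → ValidOrdering (_< 0ℤ) rest →
                     ValidOrdering (0ℤ <_) (x ∷ rest)
  prepend-reversed {x} {rest} 0<S (ys , ys↭ , negative , unique) =
    x ∷ reverse ys , ↭-prep x (↭-trans (↭-reverse ys) ys↭) ,
    All-resp-↭ (↭-sym (sums-∷-reverse x ys))
      (All.map⁺ (All.map (ℤ.+-mono-<-≤ 0<S′ ∘ ℤ.neg-mono-≤) nonPos)) ,
    Unique-resp-↭ (↭-sym (sums-∷-reverse x ys))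
      (Unique.map⁺ (ℤ.neg-injective ∘ ∙-cancelˡ (x + ∑ ys) _ _) unique₀)
    where
    0<S′ : 0ℤ < x + ∑ ys
    0<S′ = subst (λ t → 0ℤ < x + t) (sym (∑-↭ ys↭)) 0<S
    nonPos : All (_≤ 0ℤ) (0ℤ ∷ sums ys)
    nonPos = ℤ.≤-refl ∷ All.map ℤ.<⇒≤ negative
    unique₀ : Unique (0ℤ ∷ sums ys)
    unique₀ = All.map (≢-sym ∘ ℤ.<⇒≢) negative ∷ unique

  singleton-ordering : ∀ {xs} → Unique xs → All (_≢ 0ℤ) xs → 0ℤ < ∑ xs →
                       All (λ x → x ≢ ∑ xs → x ≤ 0ℤ) xs → ValidOrdering (0ℤ <_) xs
  singleton-ordering {xs} unique ≢0 0<S others with any? (ℤ._≟ ∑ xs) xs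
  ... | no S∉xs = ⊥-elim (ℤ.<-irrefl refl (ℤ.<-≤-trans 0<S
    (∑-nonPos (All.zipWith (λ (other , x≢S) → other x≢S) (others , All.¬Any⇒All¬ xs S∉xs)))))
  ... | yes S∈xs
    with _ , rest , refl , xs↭ ← ↭-pick S∈xs
    with S∉rest ∷ _ ← Unique-resp-↭ xs↭ unique
    with _ ∷ others′ ← All-resp-↭ xs↭ others
    with _ ∷ ≢0′ ← All-resp-↭ xs↭ ≢0
    with rest
  ... | []     = [ ∑ xs ] , ↭-sym xs↭ , 0<S ∷ [] , [] ∷ []
  ... | y ∷ ys = ⊥-elim (ℤ.<⇒≢ (∑-negative negative) ∑rest≡0)
    where
    negative : All (_< 0ℤ) (y ∷ ys)
    negative = All.zipWith (λ (other , S≢y , y≢0) → ℤ.≤∧≢⇒< (other (≢-sym S≢y)) y≢0)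
                           (others′ , All.zip (S∉rest , ≢0′))
    ∑rest≡0 : ∑ (y ∷ ys) ≡ 0ℤ
    ∑rest≡0 = sym (∙-cancelˡ (∑ xs) 0ℤ _ (trans (ℤ.+-identityʳ (∑ xs)) (∑-↭ xs↭)))

  Unique-neg : ∀ {xs} → Unique xs → Unique (map -_ xs)
  Unique-neg = Unique.map⁺ ℤ.neg-injective

  ≢0-neg : ∀ {xs} → All (_≢ 0ℤ) xs → All (_≢ 0ℤ) (map -_ xs)
  ≢0-neg = All.map⁺ ∘ All.map (_∘ ℤ.neg-injective)

  ∑-neg-positive : ∀ xs → ∑ xs < 0ℤ → 0ℤ < ∑ (map -_ xs)
  ∑-neg-positive xs ∑<0 = subst (0ℤ <_) (sym (∑-neg xs)) (ℤ.neg-mono-< ∑<0)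

  -- Put first an element strictly between 0 and the total; failing that, one above the total
  -- followed by the reversal of an ordering of the rest with negative partial sums; failing
  -- both, the list is the singleton [total].
  positive-ordering : ∀ n xs → length xs ≡ n → Unique xs → All (_≢ 0ℤ) xs → 0ℤ < ∑ xs →
                      ValidOrdering (0ℤ <_) xs
  positive-ordering zero    []      _   _      _  0<0 = ⊥-elim (ℤ.<-irrefl refl 0<0)
  positive-ordering zero    (_ ∷ _) ()
  positive-ordering (suc n) xs      len unique ≢0 0<S
    with any? (λ x → 0ℤ ℤ.<? x ×-dec ¬? (x ℤ.≟ ∑ xs)) xs
  ... | no none = singleton-ordering unique ≢0 0<S
    (All.map (λ ¬other x≢S → ℤ.≮⇒≥ (λ 0<x → ¬other (0<x , x≢S))) (All.¬Any⇒All¬ xs none))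
  ... | yes some
    with x , rest , (0<x , x≢S) , xs↭ ← ↭-pick some
    with _ ∷ unique′ ← Unique-resp-↭ xs↭ unique
    with _ ∷ ≢0′ ← All-resp-↭ xs↭ ≢0
    = ValidOrdering-resp-↭ (↭-sym xs↭) (by-position (ℤ.<-cmp x (∑ xs)))
    where
    S≡x+∑rest : ∑ xs ≡ x + ∑ rest
    S≡x+∑rest = ∑-↭ xs↭
    len′ : length rest ≡ n
    len′ = ℕ.suc-injective (trans (sym (↭-length xs↭)) len)
    by-position : Tri (x < ∑ xs) (x ≡ ∑ xs) (∑ xs < x) → ValidOrdering (0ℤ <_) (x ∷ rest)
    by-position (tri< x<S _ _) = prepend-positive 0<x
      (positive-ordering n rest len′ unique′ ≢0′
        (+-cancelˡ-< x (subst₂ _<_ (sym (ℤ.+-identityʳ x)) S≡x+∑rest x<S)))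
    by-position (tri≈ _ x≡S _) = ⊥-elim (x≢S x≡S)
    by-position (tri> _ _ S<x) = prepend-reversed (subst (0ℤ <_) S≡x+∑rest 0<S) (ValidOrdering-neg
      (positive-ordering n (map -_ rest) (trans (List.length-map -_ rest) len′)
        (Unique-neg unique′) (≢0-neg ≢0′)
        (∑-neg-positive rest (+-cancelˡ-< x (subst₂ _<_ S≡x+∑rest (sym (ℤ.+-identityʳ x)) S<x)))))

  nonzero-sum-ordering : ∀ xs → Unique xs → All (_≢ 0ℤ) xs → ∑ xs ≢ 0ℤ → ValidOrdering (_≢ 0ℤ) xs
  nonzero-sum-ordering xs unique ≢0 ∑≢0 with ℤ.<-cmp (∑ xs) 0ℤ
  ... | tri< ∑<0 _ _ = ValidOrdering-mono ℤ.<⇒≢ (ValidOrdering-neg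
    (positive-ordering _ (map -_ xs) refl (Unique-neg unique) (≢0-neg ≢0) (∑-neg-positive xs ∑<0)))
  ... | tri≈ _ ∑≡0 _ = ⊥-elim (∑≢0 ∑≡0)
  ... | tri> _ _ 0<∑ = ValidOrdering-mono (≢-sym ∘ ℤ.<⇒≢) (positive-ordering _ xs refl unique ≢0 0<∑)

  ∑-tail-≢0 : ∀ {x} xs → x ≢ 0ℤ → ∑ (x ∷ xs) ≡ 0ℤ → ∑ xs ≢ 0ℤ
  ∑-tail-≢0 {x} xs x≢0 ∑≡0 ∑xs≡0 =
    x≢0 (trans (trans (sym (ℤ.+-identityʳ x)) (cong (x +_) (sym ∑xs≡0))) ∑≡0)

  distinct-sums-ordering : ∀ xs → Unique xs → All (_≢ 0ℤ) xs → ∃[ ys ] (ys ↭ xs × Unique (sums ys))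
  distinct-sums-ordering []       _                     _              = [] , ↭-refl , []
  distinct-sums-ordering (x ∷ xs) unique@(_ ∷ unique′) ≢0@(x≢0 ∷ ≢0′) with ∑ (x ∷ xs) ℤ.≟ 0ℤ
  ... | no ∑≢0 with ys , ys↭ , _ , unique″ ← nonzero-sum-ordering (x ∷ xs) unique ≢0 ∑≢0 =
    ys , ys↭ , unique″
  ... | yes ∑≡0
    with ys , ys↭ , ≢0″ , unique″ ← nonzero-sum-ordering xs unique′ ≢0′ (∑-tail-≢0 xs x≢0 ∑≡0) =
    x ∷ ys , ↭-prep x ys↭ , prepend-Unique x ≢0″ unique″

module Lifting where

  open Lists
  open IntegerOrderings
  open Congruences
  open import Data.Nat as ℕ using (ℕ; NonZero)
  import Data.Nat.Properties as ℕ
  open import Data.Nat.DivMod using (_%_)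
  open import Data.Nat.ListAction using (sum)
  open import Data.Nat.ListAction.Properties using (sum-↭)
  open import Data.Nat.Primality using (Prime)
  open import Data.Integer as ℤ using (ℤ; +_; 0ℤ; _+_; _-_; -_; _*_; ∣_∣)
  import Data.Integer.Properties as ℤ
  open import Data.Integer.Tactic.RingSolver using (solve-∀)
  open import Data.List using (List; []; _∷_; map; drop)
  import Data.List.Properties as List
  open import Data.List.Relation.Unary.All as All using (All; []; _∷_)
  import Data.List.Relation.Unary.All.Properties as All
  open import Data.List.Relation.Unary.AllPairs as AllPairs using (AllPairs; []; _∷_)
  import Data.List.Relation.Unary.AllPairs.Properties as AllPairs
  open import Data.List.Relation.Binary.Pointwise as Pointwise using (Pointwise; []; _∷_)
  open import Data.List.Relation.Unary.Unique.Propositional using (Unique)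
  open import Data.List.Relation.Binary.Permutation.Propositional using (_↭_; ↭-sym)
  import Data.List.Relation.Binary.Permutation.Propositional.Properties as Permutation
  open import Data.Product using (_×_; _,_; ∃-syntax)
  open import Relation.Nullary using (¬_)
  open import Relation.Binary.PropositionalEquality
    using (_≡_; _≢_; refl; sym; trans; cong; subst; subst₂; module ≡-Reasoning)

  partialSums-shift : ∀ s xs → drop 1 (partialSums (s ∷ xs)) ≡ map (s ℕ.+_) (partialSums xs)
  partialSums-shift s []       = refl
  partialSums-shift s (x ∷ xs) = cong (s ℕ.+ x ∷_) (begin
    drop 1 (partialSums (s ℕ.+ x ∷ xs))          ≡⟨ partialSums-shift (s ℕ.+ x) xs ⟩
    map (s ℕ.+ x ℕ.+_) (partialSums xs)          ≡⟨ List.map-cong (ℕ.+-assoc s x) (partialSums xs) ⟩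
    map (λ n → s ℕ.+ (x ℕ.+ n)) (partialSums xs) ≡⟨ List.map-∘ (partialSums xs) ⟩
    map (s ℕ.+_) (map (x ℕ.+_) (partialSums xs)) ≡⟨ cong (map (s ℕ.+_)) (partialSums-shift x xs) ⟨
    map (s ℕ.+_) (drop 1 (partialSums (x ∷ xs))) ∎)
    where open ≡-Reasoning

  partialSums-∷ : ∀ x xs → partialSums (x ∷ xs) ≡ x ∷ map (x ℕ.+_) (partialSums xs)
  partialSums-∷ x xs = cong (x ∷_) (partialSums-shift x xs)

  ‖_‖ : List ℤ → ℕ
  ‖ xs ‖ = sum (map ∣_∣ xs)

  sums-bounded : ∀ xs → All (λ s → ∣ s ∣ ℕ.≤ ‖ xs ‖) (sums xs)
  sums-bounded []       = []
  sums-bounded (x ∷ xs) = ℕ.m≤m+n ∣ x ∣ ‖ xs ‖ ∷ All.map⁺ (All.map shifted (sums-bounded xs))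
    where
    shifted : ∀ {s} → ∣ s ∣ ℕ.≤ ‖ xs ‖ → ∣ x + s ∣ ℕ.≤ ∣ x ∣ ℕ.+ ‖ xs ‖
    shifted {s} ∣s∣≤ = ℕ.≤-trans (ℤ.∣i+j∣≤∣i∣+∣j∣ x s) (ℕ.+-monoʳ-≤ ∣ x ∣ ∣s∣≤)

  sums-close : ∀ xs → AllPairs (λ s t → ∣ s - t ∣ ℕ.≤ ‖ xs ‖) (sums xs)
  sums-close []       = []
  sums-close (x ∷ xs) =
    All.map⁺ (All.map first (sums-bounded xs)) ∷ AllPairs.map⁺ (AllPairs.map later (sums-close xs))
    where
    first : ∀ {s} → ∣ s ∣ ℕ.≤ ‖ xs ‖ → ∣ x - (x + s) ∣ ℕ.≤ ∣ x ∣ ℕ.+ ‖ xs ‖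
    first {s} ∣s∣≤ = subst (ℕ._≤ ∣ x ∣ ℕ.+ ‖ xs ‖) (trans (sym (ℤ.∣-i∣≡∣i∣ s)) (cong ∣_∣ (sym (cancel x s))))
      (ℕ.m≤n⇒m≤o+n ∣ x ∣ ∣s∣≤)
      where
      cancel : ∀ x s → x - (x + s) ≡ - s
      cancel = solve-∀
    later : ∀ {s t} → ∣ s - t ∣ ℕ.≤ ‖ xs ‖ → ∣ (x + s) - (x + t) ∣ ℕ.≤ ∣ x ∣ ℕ.+ ‖ xs ‖
    later {s} {t} ∣s-t∣≤ = subst (ℕ._≤ ∣ x ∣ ℕ.+ ‖ xs ‖) (cong ∣_∣ (sym (cancel x s t)))
      (ℕ.m≤n⇒m≤o+n ∣ x ∣ ∣s-t∣≤)
      where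
      cancel : ∀ x s t → (x + s) - (x + t) ≡ s - t
      cancel = solve-∀

  module _ {p : ℕ} (D : ℤ) (w : ℕ → ℤ) where

    sums≡D*partialSums : ∀ {xs} → All (λ a → w a ≡ D * + a mod p) xs →
                         Pointwise (λ s n → s ≡ D * + n mod p) (sums (map w xs)) (partialSums xs)
    sums≡D*partialSums {[]}     []           = []
    sums≡D*partialSums {a ∷ xs} (wa≡Da ∷ ws) rewrite partialSums-∷ a xs =
      wa≡Da ∷ Pointwise.map⁺ (_+_ (w a)) (a ℕ.+_) (Pointwise.map shift (sums≡D*partialSums ws))
      where
      shift : ∀ {s n} → s ≡ D * + n mod p → w a + s ≡ D * + (a ℕ.+ n) mod p
      shift {s} {n} s≡Dn = subst (λ t → w a + s ≡ t mod p)
        (sym (trans (cong (D *_) (ℤ.pos-+ a n)) (ℤ.*-distribˡ-+ D (+ a) (+ n))))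
        (+-cong-mod wa≡Da s≡Dn)

    distinct-sums⇒distinct-residues : .{{_ : NonZero p}} → ∀ {σ} →
      All (λ a → w a ≡ D * + a mod p) σ → ‖ map w σ ‖ ℕ.< p →
      Unique (sums (map w σ)) → Unique (partialSumsMod p σ)
    distinct-sums⇒distinct-residues {σ} w≡Da ‖w‖<p unique = AllPairs.map⁺
      (AllPairs-transport distinct (sums≡D*partialSums w≡Da) (AllPairs.zip (unique , sums-close (map w σ))))
      where
      distinct : ∀ {s s′ n n′} → s ≡ D * + n mod p → s′ ≡ D * + n′ mod p →
                 s ≢ s′ × ∣ s - s′ ∣ ℕ.≤ ‖ map w σ ‖ → n % p ≢ n′ % p
      distinct s≡Dn s′≡Dn′ (s≢s′ , close) n≡n′ = s≢s′ (≡-mod⇒≡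
        (≡-mod-trans s≡Dn (≡-mod-trans (*-congˡ-mod D (%≡%⇒≡-mod n≡n′)) (≡-mod-sym s′≡Dn′)))
        (ℕ.≤-<-trans close ‖w‖<p))

  module _ {p : ℕ} .{{_ : NonZero p}} (p-prime : Prime p)
           (D : ℤ) (D≢0 : ¬ (D ≡ 0ℤ mod p)) (w : ℕ → ℤ) where

    private
      Lifts : ℕ → Set
      Lifts a = (0 ℕ.< a × a ℕ.< p) × w a ≡ D * + a mod p

      w-injective : ∀ {a b} → Lifts a → Lifts b → w a ≡ w b → a ≡ b
      w-injective {a} {b} ((_ , a<p) , wa≡Da) ((_ , b<p) , wb≡Db) wa≡wb = residues-≡-mod⇒≡
        (*-cancelˡ-mod p-prime D≢0
          (≡-mod-trans (≡-mod-sym wa≡Da) (subst (λ t → t ≡ D * + b mod p) (sym wa≡wb) wb≡Db)))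
        a<p b<p

      w-nonzero : ∀ {a} → Lifts a → w a ≢ 0ℤ
      w-nonzero {a} ((0<a , a<p) , wa≡Da) wa≡0 = nonzero-residue 0<a a<p (*-cancelˡ-mod p-prime D≢0
        (subst₂ (λ s t → s ≡ t mod p) refl (sym (ℤ.*-zeroʳ D))
          (subst (λ t → D * + a ≡ t mod p) wa≡0 (≡-mod-sym wa≡Da))))

    valid-ordering-of-lift : ∀ {A} → Unique A → All (λ a → 0 ℕ.< a × a ℕ.< p) A →
                             All (λ a → w a ≡ D * + a mod p) A → ‖ map w A ‖ ℕ.< p →
                             ∃[ σ ] (σ ↭ A × Unique (partialSumsMod p σ))
    valid-ordering-of-lift {A} unique range w≡Da ‖w‖<p
      with τ , τ↭ , distinct ← distinct-sums-ordering (map w A)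
             (Unique-map-on w-injective (All.zip (range , w≡Da)) unique)
             (All.map⁺ (All.map w-nonzero (All.zip (range , w≡Da))))
      with σ , refl , A↭σ ← Permutation.↭-map-inv w (↭-sym τ↭)
      = σ , ↭-sym A↭σ , distinct-sums⇒distinct-residues D w (Permutation.All-resp-↭ A↭σ w≡Da)
          (subst (ℕ._< p) (sum-↭ (Permutation.map⁺ ∣_∣ (Permutation.map⁺ w A↭σ))) ‖w‖<p) distinct

open import Data.Nat as ℕ using (ℕ; _<_; NonZero; z≤n; s≤s; _^_)
import Data.Nat.Properties as ℕ
open import Data.Nat.DivMod using (_%_)
open import Data.Nat.Divisibility using (divides)
open import Data.Nat.Primality using (Prime; composite-≢)
open import Data.Integer as ℤ using (ℤ; +_; 0ℤ; _+_; _-_; _*_; ∣_∣)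
import Data.Integer.Properties as ℤ
open import Data.Integer.Divisibility.Signed using (_∣_; _∣?_)
open import Data.Integer.Tactic.RingSolver using (solve-∀)
open import Data.List using (List; []; _∷_; map; length)
import Data.List.Properties as List
open import Data.List.Relation.Unary.All as All using (All; []; _∷_)
import Data.List.Relation.Unary.All.Properties as All
open import Data.List.Relation.Unary.AllPairs using ([]; _∷_)
open import Data.List.Relation.Unary.Unique.Propositional using (Unique)
open import Data.List.Relation.Binary.Permutation.Propositional
  using (_↭_; ↭-refl; ↭-trans; ↭-prep; ↭-swap)
open import Data.Product using (_×_; _,_; proj₁; proj₂; ∃-syntax)
open import Function using (_∘_)
open import Relation.Nullary using (¬_; yes; no)
open import Relation.Binary.PropositionalEquality
  using (_≡_; _≢_; refl; sym; trans; cong; cong₂; subst; subst₂)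
open Lists using (Unique⇒length≤; *n<p⇒sum<p)
open ExponentialSeries using (LogBound⇒^≤)
open Congruences
open Dirichlet using (dirichlet)
open Lifting using (‖_‖; valid-ordering-of-lift)

module _ {p : ℕ} .{{_ : NonZero p}} where

  shift-%-≢ : ∀ s {t} → ¬ (+ t ≡ 0ℤ mod p) → s % p ≢ (s ℕ.+ t) % p
  shift-%-≢ s {t} t≢0 s≡s+t = t≢0 (subst₂ (λ u v → u ≡ v mod p) difference (ℤ.+-inverseʳ (+ s))
    (-‿cong-mod (≡-mod-sym (%≡%⇒≡-mod s≡s+t)) (≡-mod-refl (+ s))))
    where
    cancel : ∀ s t → (s + t) - s ≡ t
    cancel = solve-∀
    difference : + (s ℕ.+ t) - + s ≡ + t
    difference = trans (cong (_- + s) (ℤ.pos-+ s t)) (cancel (+ s) (+ t))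

  valid-triple : ∀ a {b c} → ¬ (+ b ≡ 0ℤ mod p) → ¬ (+ c ≡ 0ℤ mod p) →
                 ¬ (+ (b ℕ.+ c) ≡ 0ℤ mod p) → Unique (partialSumsMod p (a ∷ b ∷ c ∷ []))
  valid-triple a {b} {c} b≢0 c≢0 b+c≢0 =
    (shift-%-≢ a b≢0 ∷ subst (λ n → a % p ≢ n % p) (sym (ℕ.+-assoc a b c)) (shift-%-≢ a b+c≢0) ∷ [])
    ∷ (shift-%-≢ (a ℕ.+ b) c≢0 ∷ []) ∷ [] ∷ []

  -- If b + c ≡ 0 then c + a ≢ 0, as otherwise a ≡ b; so one of the two rotations works.
  small-valid-ordering : ∀ A → Unique A → All (λ a → 0 < a × a < p) A → length A ℕ.≤ 3 →
                         ∃[ σ ] (σ ↭ A × Unique (partialSumsMod p σ))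
  small-valid-ordering []           _ _ _ = [] , ↭-refl , []
  small-valid-ordering (a ∷ [])     _ _ _ = a ∷ [] , ↭-refl , [] ∷ []
  small-valid-ordering (a ∷ b ∷ []) _ (_ ∷ (0<b , b<p) ∷ []) _ =
    a ∷ b ∷ [] , ↭-refl , (shift-%-≢ a (nonzero-residue 0<b b<p) ∷ []) ∷ [] ∷ []
  small-valid-ordering (a ∷ b ∷ c ∷ []) ((a≢b ∷ _) ∷ _)
                       ((0<a , a<p) ∷ (0<b , b<p) ∷ (0<c , c<p) ∷ []) _
    with + p ∣? (+ (b ℕ.+ c) - 0ℤ)
  ... | no p∤b+c = a ∷ b ∷ c ∷ [] , ↭-refl ,
    valid-triple a (nonzero-residue 0<b b<p) (nonzero-residue 0<c c<p) (p∤b+c ∘ p∣i-j)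
  ... | yes p∣b+c = b ∷ c ∷ a ∷ [] , ↭-trans (↭-prep b (↭-swap c a ↭-refl)) (↭-swap b a ↭-refl) ,
    valid-triple b (nonzero-residue 0<c c<p) (nonzero-residue 0<a a<p) c+a≢0
    where
    cancel : ∀ b c a → ((b + c) - (c + a)) - (0ℤ - 0ℤ) ≡ b - a
    cancel = solve-∀
    difference : (+ (b ℕ.+ c) - + (c ℕ.+ a)) - (0ℤ - 0ℤ) ≡ + b - + a
    difference = trans (cong₂ (λ u v → (u - v) - (0ℤ - 0ℤ)) (ℤ.pos-+ b c) (ℤ.pos-+ c a))
                       (cancel (+ b) (+ c) (+ a))
    c+a≢0 : ¬ (+ (c ℕ.+ a) ≡ 0ℤ mod p)
    c+a≢0 c+a≡0 = a≢b (sym (residues-≡-mod⇒≡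
      (≡-mod (subst (+ p ∣_) difference (p∣i-j (-‿cong-mod (≡-mod {+ (b ℕ.+ c)} {0ℤ} p∣b+c) c+a≡0))))
      b<p a<p))
  small-valid-ordering (_ ∷ _ ∷ _ ∷ _ ∷ _) _ _ (s≤s (s≤s (s≤s ())))

large-valid-ordering : ∀ {p} .{{_ : NonZero p}} → Prime p → ∀ A .{{_ : NonZero (length A)}} →
                       length A ^ length A < p → Unique A → All (λ a → 0 < a × a < p) A →
                       ∃[ σ ] (σ ↭ A × Unique (partialSumsMod p σ))
large-valid-ordering {p} p-prime A kᵏ<p unique range
  with l₁ , l₂ , l₁<l₂ , l₂<p , small ← dirichlet {p} {length A} A kᵏ<p
  = valid-ordering-of-lift p-prime D D≢0 w unique range (All.universal w≡Da A) ‖w‖<p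
  where
  D : ℤ
  D = + l₂ - + l₁
  w : ℕ → ℤ
  w a = + ((l₂ ℕ.* a) % p) - + ((l₁ ℕ.* a) % p)
  distrib : ∀ l₂ l₁ a → l₂ * a - l₁ * a ≡ (l₂ - l₁) * a
  distrib = solve-∀
  w≡Da : ∀ a → w a ≡ D * + a mod p
  w≡Da a = subst (λ t → w a ≡ t mod p)
    (trans (cong₂ _-_ (ℤ.pos-* l₂ a) (ℤ.pos-* l₁ a)) (distrib (+ l₂) (+ l₁) (+ a)))
    (-‿cong-mod (%-≡-mod (l₂ ℕ.* a)) (%-≡-mod (l₁ ℕ.* a)))
  D≢0 : ¬ (D ≡ 0ℤ mod p)
  D≢0 D≡0 = ℕ.<-irrefl (residues-≡-mod⇒≡ l₁≡l₂ (ℕ.<-trans l₁<l₂ l₂<p) l₂<p) l₁<l₂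
    where
    l₁≡l₂ : + l₁ ≡ + l₂ mod p
    l₁≡l₂ = ≡-mod-sym (≡-mod (subst (+ p ∣_) (ℤ.+-identityʳ D) (p∣i-j D≡0)))
  ‖w‖<p : ‖ map w A ‖ < p
  ‖w‖<p = *n<p⇒sum<p (map ∣_∣ (map w A))
    (ℕ.≤-reflexive (trans (List.length-map ∣_∣ (map w A)) (List.length-map w A)))
    (All.map⁺ (All.map⁺ small))

^-self≢prime : ∀ {p k} → Prime p → 2 ℕ.≤ k → k ^ k ≢ p
^-self≢prime {p} {k@(ℕ.suc k′)} p-prime 2≤k refl = Prime.notComposite p-prime
  (composite-≢ k {{ℕ.n>1⇒nonTrivial 2≤k}} {{ℕ.m^n≢0 k k}} k≢kᵏ (divides (k ^ k′) (ℕ.*-comm k (k ^ k′))))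
  where
  k≢kᵏ : k ≢ k ^ k
  k≢kᵏ k≡kᵏ = ℕ.<-irrefl (trans (ℕ.^-identityʳ k) k≡kᵏ) (ℕ.^-monoʳ-< k 2≤k 2≤k)

theorem2 : (p : ℕ) .{{_ : NonZero p}} → Prime p →
           (A : List ℕ) → Unique A → All (λ a → 0 < a × a < p) A →
           LogBound p (length A) →
           ∃[ σ ] (σ ↭ A × Unique (partialSumsMod p σ))
theorem2 p p-prime A unique range logBound with length A ℕ.≤? 3
... | yes k≤3 = small-valid-ordering A unique range k≤3
... | no  k≰3 =
  large-valid-ordering p-prime A {{ℕ.>-nonZero (ℕ.<-trans (s≤s z≤n) 4≤k)}} kᵏ<p unique range
  where
  4≤k : 4 ℕ.≤ length A
  4≤k = ℕ.≰⇒> k≰3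
  5≤p : 5 ℕ.≤ p
  5≤p = ℕ.≤-trans (s≤s 4≤k)
    (Unique⇒length≤ p (All.map (ℕ.<⇒≢ ∘ proj₁) range ∷ unique)
                      (ℕ.>-nonZero⁻¹ p ∷ All.map proj₂ range))
  kᵏ<p : length A ^ length A < p
  kᵏ<p = ℕ.≤∧≢⇒< (LogBound⇒^≤ 5≤p 4≤k logBound)
                   (^-self≢prime p-prime (ℕ.≤-trans (s≤s (s≤s z≤n)) 4≤k))
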